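{- The map $\Phi$ is injective from $\mathcal{BWTSL}(n)$ to $\mathcal{FF}(n)$ for every $n\ge1$.
   Context: A red and white tree of weight $n$ is a rooted tree with unordered children, each node carrying a (possibly empty) set of labels, label sets pairwise disjoint with union $\{1,\dots,n\}$, every node with empty label set having at least two children; a node with non-empty label set is white, a node with empty label set is red iff all its children are white (white otherwise). $\mathcal{BWTSL}(n)$ is the set of these trees. $\mathcal{FF}(n)$ is the set of formal fractions whose numerator and denominator are products of formal symbols $[S]$, $S$ a non-empty subset of $\{1,\dots,n\}$, with cancellation of common symbols (free abelian group on the $[S]$). For a tree $T$ and a node $z$, let $S(z)$ be the set of all labels in the subtree rooted at $z$, and let $E(z)=1/[S(z)]$ if $z$ is white, $E(z)=[S(z)]$ if $z$ is red and not the root, $E(z)=1$ if $z$ is red and the root. Then $\Phi(T)=\prod_{z}E(z)$, the product over all nodes of $T$. -}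

module Defs where

open import Data.Nat using (ℕ; _≤_)
open import Data.Bool using (Bool; true; false; not; _∨_; _∧_; if_then_else_)
open import Data.Fin using (Fin)
open import Data.Fin.Subset using (Subset; _∪_; _∩_; ⊥; ⊤; ⋃; Empty)
open import Data.Fin.Subset.Properties using (nonempty?)
open import Data.Vec.Properties using (≡-dec)
open import Data.Bool.Properties using () renaming (_≟_ to _≟B_)
open import Data.List using (List; []; _∷_; _++_; length)
open import Data.List.Relation.Unary.All using (All)
open import Data.List.Relation.Unary.AllPairs using (AllPairs)
open import Data.List.Relation.Binary.Permutation.Homogeneous using (Permutation)
open import Data.Integer using (ℤ; 0ℤ; 1ℤ; _+_; -_)
open import Data.Product using (_×_)
open import Data.Unit using () renaming (⊤ to Unit)
open import Relation.Nullary.Decidable using (⌊_⌋; yes; no)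
open import Relation.Binary.PropositionalEquality using (_≡_)

-- Children are unordered: trees are compared up to
-- the isomorphism relation _≅_ below (permutation of children at each node).
data Tree (n : ℕ) : Set where
  node : Subset n → List (Tree n) → Tree n

data _≅_ {n : ℕ} : Tree n → Tree n → Set where
  node : ∀ {p q cs ds} → p ≡ q → Permutation _≅_ cs ds → node p cs ≅ node q ds

mutual
  labelSets : ∀ {n} → Tree n → List (Subset n)
  labelSets (node p cs) = p ∷ labelSetsL cs

  labelSetsL : ∀ {n} → List (Tree n) → List (Subset n)
  labelSetsL [] = []
  labelSetsL (c ∷ cs) = labelSets c ++ labelSetsL cs

Disjoint : ∀ {n} → Subset n → Subset n → Set
Disjoint p q = Empty (p ∩ q)

mutual
  EmptyBranching : ∀ {n} → Tree n → Set
  EmptyBranching (node p cs) = (Empty p → 2 ≤ length cs) × EmptyBranchingL cs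

  EmptyBranchingL : ∀ {n} → List (Tree n) → Set
  EmptyBranchingL [] = Unit
  EmptyBranchingL (c ∷ cs) = EmptyBranching c × EmptyBranchingL cs

IsBWTSL : ∀ {n} → Tree n → Set
IsBWTSL T = AllPairs Disjoint (labelSets T) × (⋃ (labelSets T) ≡ ⊤) × EmptyBranching T

mutual
  S : ∀ {n} → Tree n → Subset n
  S (node p cs) = p ∪ SL cs

  SL : ∀ {n} → List (Tree n) → Subset n
  SL [] = ⊥
  SL (c ∷ cs) = S c ∪ SL cs

-- Colour: white = true.  A node with non-empty label set is white; a node
-- with empty label set is red iff all its children are white.
mutual
  isWhite : ∀ {n} → Tree n → Bool
  isWhite (node p cs) = ⌊ nonempty? p ⌋ ∨ not (allWhite cs)

  allWhite : ∀ {n} → List (Tree n) → Bool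
  allWhite [] = true
  allWhite (c ∷ cs) = isWhite c ∧ allWhite cs

-- Formal fractions FF(n): elements of the free abelian group on the symbols
-- [S], represented by their exponent function Subset n → ℤ (finite support
-- automatic).
FF : ℕ → Set
FF n = Subset n → ℤ

_≈FF_ : ∀ {n} → FF n → FF n → Set
f ≈FF g = ∀ X → f X ≡ g X

δ : ∀ {n} → Subset n → Subset n → ℤ
δ X Y with ≡-dec _≟B_ X Y
... | yes _ = 1ℤ
... | no _ = 0ℤ

E : ∀ {n} → Bool → Tree n → Subset n → ℤ
E isRoot z X =
  if isWhite z then - (δ (S z) X)
  else (if isRoot then 0ℤ else δ (S z) X)

-- Φ(T) = ∏_z E(z), written additively on exponents.
mutual
  Φ′ : ∀ {n} → Bool → Tree n → FF n
  Φ′ isRoot T@(node p cs) X = E isRoot T X + ΦL cs X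

  ΦL : ∀ {n} → List (Tree n) → FF n
  ΦL [] X = 0ℤ
  ΦL (c ∷ cs) X = Φ′ false c X + ΦL cs X

Φ : ∀ {n} → Tree n → FF n
Φ = Φ′ true

-- In a BWTSL tree the label sets are disjoint and every
-- unlabelled node has at least two children, so the set S(c) of a child is a proper
-- subset of its parent's and the sets of siblings are disjoint. Hence a non-root
-- node set X = S(z) belongs to the node z only, the exponent of [X] in Φ(T) is the
-- contribution ±1 of z, and every symbol that is not a node set has exponent 0.
-- So Φ(T) determines the family of node sets (the root set being {1,…,n}), and
-- this laminar family determines the tree: each child c of the root is matched by
-- the child of the other root with the same set S(c), and the labels of a node are
-- what S(z) leaves after removing the sets of its children.

module Submission where

open import Defs
open import Data.Nat using (ℕ; _≤_; s≤s)
open import Data.Bool using (Bool; true; false)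
open import Data.Bool.Properties using () renaming (_≟_ to _≟B_)
open import Data.Fin using (Fin)
open import Data.Fin.Subset using (Subset; _∪_; ⋃; Nonempty; Empty; _∈_; _∉_; _⊆_; _⊂_) renaming (⊤ to Full)
open import Data.Fin.Subset.Properties using (nonempty?; x∈p∪q⁺; x∈p∪q⁻; x∈p∩q⁺; ∉⊥; ∈⊤; ⊆⊤; ⊆-antisym; p⊆p∪q; q⊆p∪q)
open import Data.Vec.Properties using (≡-dec)
open import Data.Integer using (ℤ; 0ℤ; 1ℤ; _+_; -_)
open import Data.Integer.Properties using (+-identityˡ; +-identityʳ)
open import Data.List using (List; []; _∷_; _++_; length)
open import Data.List.Relation.Unary.All as All using (All; []; _∷_)
import Data.List.Relation.Unary.All.Properties as All
open import Data.List.Relation.Unary.Any using (Any; here; there; _─_)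
import Data.List.Relation.Unary.Any.Properties as Any
open import Data.List.Relation.Unary.AllPairs using (AllPairs; []; _∷_)
open import Data.List.Relation.Binary.Pointwise using (Pointwise; []; _∷_)
import Data.List.Relation.Binary.Pointwise.Properties as Pointwise
open import Data.List.Relation.Binary.Permutation.Homogeneous as Perm using (Permutation)
open import Data.List.Relation.Binary.Subset.Propositional using () renaming (_⊆_ to _⊆ᴸ_)
open import Data.List.Membership.Propositional using (find; lose) renaming (_∈_ to _∈ᴸ_; _∉_ to _∉ᴸ_)
open import Data.List.Membership.Propositional.Properties using (∈-++⁻; ∈-++⁺ˡ; ∈-++⁺ʳ)
import Data.List.Membership.DecPropositional as DecMembership
open import Data.Product using (_×_; _,_; ∃)
open import Data.Sum using (_⊎_; inj₁; inj₂)
open import Data.Empty using (⊥-elim)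
open import Function using (_∘_; id; case_of_)
open import Relation.Binary using (Reflexive; Symmetric)
open import Relation.Nullary using (¬_; yes; no)
open import Relation.Binary.PropositionalEquality using (_≡_; _≢_; refl; cong; cong₂; subst; sym; trans)

private variable
  A : Set
  R : A → A → Set
  a : A
  as bs : List A
  n : ℕ
  x : Fin n
  p q X Y Z : Subset n
  Ys : List (Subset n)
  b : Bool
  c d z T₁ T₂ : Tree n
  cs ds : List (Tree n)

AllPairs-─⁺ : (a∈ : a ∈ᴸ as) → AllPairs R as → AllPairs R (as ─ a∈)
AllPairs-─⁺ (here refl) (_ ∷ pairs) = pairs
AllPairs-─⁺ (there a∈) (a′R ∷ pairs) = All.─⁺ a∈ a′R ∷ AllPairs-─⁺ a∈ pairs

AllPairs⇒All-─ : Symmetric R → (a∈ : a ∈ᴸ as) → AllPairs R as → All (R a) (as ─ a∈)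
AllPairs⇒All-─ sym-R (here refl) (aR ∷ _) = aR
AllPairs⇒All-─ sym-R (there a∈) (a′R ∷ pairs) =
  sym-R (All.lookup a′R a∈) ∷ AllPairs⇒All-─ sym-R a∈ pairs

─-↭ : Reflexive R → (a∈ : a ∈ᴸ as) → Permutation R (a ∷ (as ─ a∈)) as
─-↭ refl-R (here refl) = Perm.refl (Pointwise.refl refl-R)
─-↭ refl-R (there a∈) =
  Perm.trans (Perm.swap refl-R refl-R (Perm.refl (Pointwise.refl refl-R)))
             (Perm.prep refl-R (─-↭ refl-R a∈))

AllPairs-++⁻ : (as : List A) → AllPairs R (as ++ bs) →
               AllPairs R as × AllPairs R bs × All (λ a → All (R a) bs) as
AllPairs-++⁻ [] pairs = [] , pairs , []
AllPairs-++⁻ (a ∷ as) (aR ∷ pairs) with AllPairs-++⁻ as pairs | All.++⁻ as aR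
... | pairsₗ , pairsᵣ , cross | aRₗ , aRᵣ = aRₗ ∷ pairsₗ , pairsᵣ , aRᵣ ∷ cross

∈⋃⁻ : (Xs : List (Subset n)) → x ∈ ⋃ Xs → Any (x ∈_) Xs
∈⋃⁻ [] x∈ = ⊥-elim (∉⊥ x∈)
∈⋃⁻ (X ∷ Xs) x∈ with x∈p∪q⁻ X (⋃ Xs) x∈
... | inj₁ x∈X = here x∈X
... | inj₂ x∈Xs = there (∈⋃⁻ Xs x∈Xs)

Disjoint⇒¬Any : All (Disjoint X) Ys → x ∈ X → ¬ Any (x ∈_) Ys
Disjoint⇒¬Any X#Ys x∈X x∈Ys with All.lookupAny X#Ys x∈Ys
... | X#Y , x∈Y = X#Y (_ , x∈p∩q⁺ (x∈X , x∈Y))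

disjoint-∪≡⇒⊆ : (∀ {x} → x ∈ p → x ∉ Y) → p ∪ Y ≡ q ∪ Z → Z ⊆ Y → p ⊆ q
disjoint-∪≡⇒⊆ {q = q} {Z = Z} p#Y ∪≡ Z⊆Y x∈p with x∈p∪q⁻ q Z (subst (_ ∈_) ∪≡ (x∈p∪q⁺ (inj₁ x∈p)))
... | inj₁ x∈q = x∈q
... | inj₂ x∈Z = ⊥-elim (p#Y x∈p (Z⊆Y x∈Z))

mutual
  ≅-refl : Reflexive (_≅_ {n})
  ≅-refl {x = node p cs} = node refl (Perm.refl ≅-reflL)

  ≅-reflL : Reflexive (Pointwise (_≅_ {n}))
  ≅-reflL {x = []} = []
  ≅-reflL {x = c ∷ cs} = ≅-refl ∷ ≅-reflL

∈SL⁻ : (cs : List (Tree n)) → x ∈ SL cs → Any (λ c → x ∈ S c) cs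
∈SL⁻ [] x∈ = ⊥-elim (∉⊥ x∈)
∈SL⁻ (c ∷ cs) x∈ with x∈p∪q⁻ (S c) (SL cs) x∈
... | inj₁ x∈c = here x∈c
... | inj₂ x∈cs = there (∈SL⁻ cs x∈cs)

∈SL⁺ : Any (λ c → x ∈ S c) cs → x ∈ SL cs
∈SL⁺ (here x∈c) = x∈p∪q⁺ (inj₁ x∈c)
∈SL⁺ (there x∈cs) = x∈p∪q⁺ (inj₂ (∈SL⁺ x∈cs))

S⊆SL : c ∈ᴸ cs → S c ⊆ SL cs
S⊆SL c∈ x∈ = ∈SL⁺ (lose c∈ x∈)

mutual
  nodeSets : Tree n → List (Subset n)
  nodeSets T@(node p cs) = S T ∷ nodeSetsL cs

  nodeSetsL : List (Tree n) → List (Subset n)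
  nodeSetsL [] = []
  nodeSetsL (c ∷ cs) = nodeSets c ++ nodeSetsL cs

S∈nodeSets : (T : Tree n) → S T ∈ᴸ nodeSets T
S∈nodeSets (node p cs) = here refl

∈nodeSetsL⁻ : (cs : List (Tree n)) → X ∈ᴸ nodeSetsL cs → Any (λ c → X ∈ᴸ nodeSets c) cs
∈nodeSetsL⁻ (c ∷ cs) m with ∈-++⁻ (nodeSets c) m
... | inj₁ X∈c = here X∈c
... | inj₂ X∈cs = there (∈nodeSetsL⁻ cs X∈cs)

∈nodeSetsL⁺ : c ∈ᴸ cs → X ∈ᴸ nodeSets c → X ∈ᴸ nodeSetsL cs
∈nodeSetsL⁺ {cs = c ∷ cs} (here refl) X∈c = ∈-++⁺ˡ X∈c
∈nodeSetsL⁺ {cs = c ∷ cs} (there c∈) X∈c = ∈-++⁺ʳ (nodeSets c) (∈nodeSetsL⁺ c∈ X∈c)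

mutual
  nodeSets⊆S : (c : Tree n) → X ∈ᴸ nodeSets c → X ⊆ S c
  nodeSets⊆S (node p cs) (here refl) = id
  nodeSets⊆S (node p cs) (there m) = q⊆p∪q p (SL cs) ∘ nodeSetsL⊆SL cs m

  nodeSetsL⊆SL : (cs : List (Tree n)) → X ∈ᴸ nodeSetsL cs → X ⊆ SL cs
  nodeSetsL⊆SL (c ∷ cs) m with ∈-++⁻ (nodeSets c) m
  ... | inj₁ X∈c = p⊆p∪q (SL cs) ∘ nodeSets⊆S c X∈c
  ... | inj₂ X∈cs = q⊆p∪q (S c) (SL cs) ∘ nodeSetsL⊆SL cs X∈cs

SL-mono : (cs ds : List (Tree n)) → nodeSetsL cs ⊆ᴸ nodeSetsL ds → SL cs ⊆ SL ds
SL-mono cs ds sets⊆ x∈ with find (∈SL⁻ cs x∈)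
... | c , c∈ , x∈c = nodeSetsL⊆SL ds (sets⊆ (∈nodeSetsL⁺ c∈ (S∈nodeSets c))) x∈c

record _#_ (c d : Tree n) : Set where
  constructor separated
  field separate : ∀ {x} → x ∈ S c → x ∉ S d
open _#_

#-sym : Symmetric (_#_ {n})
#-sym c#d = separated (λ x∈d x∈c → separate c#d x∈c x∈d)

#-SL : All (c #_) cs → x ∈ S c → x ∉ SL cs
#-SL {cs = cs} c#cs x∈c x∈cs with find (∈SL⁻ cs x∈cs)
... | d , d∈ , x∈d = separate (All.lookup c#cs d∈) x∈c x∈d

#-nodeSetsL : All (c #_) cs → x ∈ X → X ⊆ S c → X ∉ᴸ nodeSetsL cs
#-nodeSetsL {cs = cs} c#cs x∈X X⊆c X∈cs = #-SL c#cs (X⊆c x∈X) (nodeSetsL⊆SL cs X∈cs x∈X)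

data WellFormed {n} : Tree n → Set where
  node : (∀ {x} → x ∈ p → x ∉ SL cs) → AllPairs _#_ cs → Nonempty (S (node p cs)) →
         All (λ c → S c ⊂ S (node p cs)) cs → All WellFormed cs → WellFormed (node p cs)

S-nonempty : WellFormed c → Nonempty (S c)
S-nonempty (node _ _ nonempty _ _) = nonempty

mutual
  nodeSets-nonempty : WellFormed c → X ∈ᴸ nodeSets c → Nonempty X
  nodeSets-nonempty w@(node _ _ _ _ _) (here refl) = S-nonempty w
  nodeSets-nonempty (node _ _ _ _ ws) (there m) = nodeSetsL-nonempty ws m

  nodeSetsL-nonempty : All WellFormed cs → X ∈ᴸ nodeSetsL cs → Nonempty X
  nodeSetsL-nonempty {cs = c ∷ cs} (w ∷ ws) m with ∈-++⁻ (nodeSets c) m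
  ... | inj₁ X∈c = nodeSets-nonempty w X∈c
  ... | inj₂ X∈cs = nodeSetsL-nonempty ws X∈cs

nodeSets-#-nodeSetsL : All (c #_) cs → WellFormed c → X ∈ᴸ nodeSets c → X ∉ᴸ nodeSetsL cs
nodeSets-#-nodeSetsL {c = c} c#cs w X∈c with nodeSets-nonempty w X∈c
... | x , x∈X = #-nodeSetsL c#cs x∈X (nodeSets⊆S c X∈c)

nodeSetsL≢S : WellFormed (node p cs) → X ∈ᴸ nodeSetsL cs → X ≢ S (node p cs)
nodeSetsL≢S {cs = cs} (node _ _ _ strict _) X∈cs refl with find (∈nodeSetsL⁻ cs X∈cs)
... | c , c∈ , X∈c with All.lookup strict c∈
... | _ , x , x∈X , x∉c = x∉c (nodeSets⊆S c X∈c x∈X)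

nodeSetsL-meeting : AllPairs _#_ cs → c ∈ᴸ cs → X ∈ᴸ nodeSetsL cs → x ∈ X → x ∈ S c → X ∈ᴸ nodeSets c
nodeSetsL-meeting {cs = c′ ∷ cs} (c′#cs ∷ apart) c∈ m x∈X x∈c with ∈-++⁻ (nodeSets c′) m | c∈
... | inj₁ X∈c′ | here refl = X∈c′
... | inj₂ X∈cs | here refl = ⊥-elim (#-SL c′#cs x∈c (nodeSetsL⊆SL cs X∈cs x∈X))
... | inj₁ X∈c′ | there c∈cs = ⊥-elim (separate (All.lookup c′#cs c∈cs) (nodeSets⊆S c′ X∈c′ x∈X) x∈c)
... | inj₂ X∈cs | there c∈cs = nodeSetsL-meeting apart c∈cs X∈cs x∈X x∈c

∈nodeSetsL-─⁻ : (d∈ : d ∈ᴸ ds) → X ∈ᴸ nodeSetsL ds → X ∈ᴸ nodeSets d ⊎ X ∈ᴸ nodeSetsL (ds ─ d∈)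
∈nodeSetsL-─⁻ {ds = d ∷ ds} (here refl) m = ∈-++⁻ (nodeSets d) m
∈nodeSetsL-─⁻ {ds = d′ ∷ ds} (there d∈) m with ∈-++⁻ (nodeSets d′) m
... | inj₁ X∈d′ = inj₂ (∈-++⁺ˡ X∈d′)
... | inj₂ X∈ds with ∈nodeSetsL-─⁻ d∈ X∈ds
...   | inj₁ X∈d = inj₁ X∈d
...   | inj₂ X∈rest = inj₂ (∈-++⁺ʳ (nodeSets d′) X∈rest)

∈nodeSetsL-─⁺ : (d∈ : d ∈ᴸ ds) → X ∈ᴸ nodeSetsL (ds ─ d∈) → X ∈ᴸ nodeSetsL ds
∈nodeSetsL-─⁺ {ds = d ∷ ds} (here refl) m = ∈-++⁺ʳ (nodeSets d) m
∈nodeSetsL-─⁺ {ds = d′ ∷ ds} (there d∈) m with ∈-++⁻ (nodeSets d′) m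
... | inj₁ X∈d′ = ∈-++⁺ˡ X∈d′
... | inj₂ X∈rest = ∈-++⁺ʳ (nodeSets d′) (∈nodeSetsL-─⁺ d∈ X∈rest)

nodeSetsL⊆ : WellFormed (node p cs) → S (node p cs) ≡ S (node q ds) →
             nodeSets (node p cs) ⊆ᴸ nodeSets (node q ds) → nodeSetsL cs ⊆ᴸ nodeSetsL ds
nodeSetsL⊆ w S≡ sets⊆ X∈cs with sets⊆ (there X∈cs)
... | here X≡S = ⊥-elim (nodeSetsL≢S w X∈cs (trans X≡S (sym S≡)))
... | there X∈ds = X∈ds

nodeSets-transfer : AllPairs _#_ ds → d ∈ᴸ ds → WellFormed c → S c ⊆ S d →
                    nodeSets c ⊆ᴸ nodeSetsL ds → nodeSets c ⊆ᴸ nodeSets d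
nodeSets-transfer {c = c} apart d∈ w c⊆d sets⊆ X∈c with nodeSets-nonempty w X∈c
... | x , x∈X = nodeSetsL-meeting apart d∈ (sets⊆ X∈c) x∈X (c⊆d (nodeSets⊆S c X∈c x∈X))

nodeSetsL-─⊆ : (d∈ : d ∈ᴸ ds) → All (c #_) cs → All WellFormed cs → S d ⊆ S c →
               nodeSetsL cs ⊆ᴸ nodeSetsL ds → nodeSetsL cs ⊆ᴸ nodeSetsL (ds ─ d∈)
nodeSetsL-─⊆ {d = d} d∈ c#cs ws d⊆c sets⊆ X∈cs with ∈nodeSetsL-─⁻ d∈ (sets⊆ X∈cs)
... | inj₂ X∈rest = X∈rest
... | inj₁ X∈d with nodeSetsL-nonempty ws X∈cs
...   | x , x∈X = ⊥-elim (#-nodeSetsL c#cs x∈X (d⊆c ∘ nodeSets⊆S d X∈d) X∈cs)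

mutual
  ≅-from-nodeSets : WellFormed T₁ → WellFormed T₂ →
                    nodeSets T₁ ⊆ᴸ nodeSets T₂ → nodeSets T₂ ⊆ᴸ nodeSets T₁ → T₁ ≅ T₂
  ≅-from-nodeSets {T₁ = node p cs} {T₂ = node q ds}
                  w₁@(node p#cs apart₁ _ _ ws₁) w₂@(node q#ds apart₂ _ _ ws₂) sets⊆ sets⊇ =
    node (⊆-antisym (disjoint-∪≡⇒⊆ p#cs S≡ (SL-mono ds cs children⊇))
                    (disjoint-∪≡⇒⊆ q#ds (sym S≡) (SL-mono cs ds children⊆)))
         (children-↭ apart₁ apart₂ ws₁ ws₂ children⊆ children⊇)
    where
      S≡ : S (node p cs) ≡ S (node q ds)
      S≡ = ⊆-antisym (nodeSets⊆S (node q ds) (sets⊆ (here refl)))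
                     (nodeSets⊆S (node p cs) (sets⊇ (here refl)))
      children⊆ : nodeSetsL cs ⊆ᴸ nodeSetsL ds
      children⊆ = nodeSetsL⊆ {q = q} {ds = ds} w₁ S≡ sets⊆
      children⊇ : nodeSetsL ds ⊆ᴸ nodeSetsL cs
      children⊇ = nodeSetsL⊆ {q = p} {ds = cs} w₂ (sym S≡) sets⊇

  children-↭ : AllPairs _#_ cs → AllPairs _#_ ds → All WellFormed cs → All WellFormed ds →
               nodeSetsL cs ⊆ᴸ nodeSetsL ds → nodeSetsL ds ⊆ᴸ nodeSetsL cs → Permutation _≅_ cs ds
  children-↭ {cs = []} {ds = []} _ _ _ _ _ _ = Perm.refl []
  children-↭ {cs = []} {ds = d ∷ ds} _ _ _ _ _ sets⊇ with sets⊇ (∈-++⁺ˡ (S∈nodeSets d))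
  ... | ()
  children-↭ {cs = c ∷ cs} {ds = ds} (c#cs ∷ apart) apart′ (w ∷ ws) ws′ sets⊆ sets⊇
    with find (∈nodeSetsL⁻ ds (sets⊆ (∈-++⁺ˡ (S∈nodeSets c))))
  ... | d , d∈ , Sc∈d =
    Perm.trans (Perm.prep c≅d (children-↭ apart (AllPairs-─⁺ d∈ apart′) ws (All.─⁺ d∈ ws′) rest⊆ rest⊇))
               (─-↭ ≅-refl d∈)
    where
      w′ : WellFormed d
      w′ = All.lookup ws′ d∈
      c⊆d : S c ⊆ S d
      c⊆d = nodeSets⊆S d Sc∈d
      -- S d is a node set of the first forest meeting S c, so it is one of c's.
      d⊆c : S d ⊆ S c
      d⊆c with S-nonempty w
      ... | x , x∈c = nodeSets⊆S c (nodeSetsL-meeting (c#cs ∷ apart) (here refl)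
                                      (sets⊇ (∈nodeSetsL⁺ d∈ (S∈nodeSets d))) (c⊆d x∈c) x∈c)
      c≅d : c ≅ d
      c≅d = ≅-from-nodeSets w w′
              (nodeSets-transfer apart′ d∈ w c⊆d (λ X∈c → sets⊆ (∈-++⁺ˡ X∈c)))
              (nodeSets-transfer (c#cs ∷ apart) (here refl) w′ d⊆c (sets⊇ ∘ ∈nodeSetsL⁺ d∈))
      rest⊆ : nodeSetsL cs ⊆ᴸ nodeSetsL (ds ─ d∈)
      rest⊆ = nodeSetsL-─⊆ d∈ c#cs ws d⊆c (λ X∈cs → sets⊆ (∈-++⁺ʳ (nodeSets c) X∈cs))
      rest⊇ : nodeSetsL (ds ─ d∈) ⊆ᴸ nodeSetsL cs
      rest⊇ = nodeSetsL-─⊆ {ds = c ∷ cs} (here refl) (AllPairs⇒All-─ #-sym d∈ apart′) (All.─⁺ d∈ ws′) c⊆d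
                           (sets⊇ ∘ ∈nodeSetsL-─⁺ d∈)

δ-self : (X : Subset n) → δ X X ≡ 1ℤ
δ-self X with ≡-dec _≟B_ X X
... | yes _ = refl
... | no X≢X = ⊥-elim (X≢X refl)

δ-distinct : X ≢ Y → δ X Y ≡ 0ℤ
δ-distinct {X = X} {Y = Y} X≢Y with ≡-dec _≟B_ X Y
... | yes X≡Y = ⊥-elim (X≢Y X≡Y)
... | no _ = refl

E-elsewhere : (z : Tree n) → S z ≢ X → E b z X ≡ 0ℤ
E-elsewhere {b = b} z S≢X with isWhite z | b
... | true | _ = cong -_ (δ-distinct S≢X)
... | false | true = refl
... | false | false = δ-distinct S≢X

E-own : (z : Tree n) → E false z (S z) ≢ 0ℤ
E-own z rewrite δ-self (S z) with isWhite z
... | true = λ ()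
... | false = λ ()

nonzero+zero : {i j : ℤ} → i ≢ 0ℤ → j ≡ 0ℤ → i + j ≢ 0ℤ
nonzero+zero {i} i≢0 refl rewrite +-identityʳ i = i≢0

zero+nonzero : {i j : ℤ} → i ≡ 0ℤ → j ≢ 0ℤ → i + j ≢ 0ℤ
zero+nonzero {j = j} refl j≢0 rewrite +-identityˡ j = j≢0

mutual
  Φ′-outside : (z : Tree n) → X ∉ᴸ nodeSets z → Φ′ b z X ≡ 0ℤ
  Φ′-outside z@(node p cs) X∉ = cong₂ _+_ (E-elsewhere z (X∉ ∘ here ∘ sym)) (ΦL-outside cs (X∉ ∘ there))

  ΦL-outside : (cs : List (Tree n)) → X ∉ᴸ nodeSetsL cs → ΦL cs X ≡ 0ℤ
  ΦL-outside [] _ = refl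
  ΦL-outside (c ∷ cs) X∉ =
    cong₂ _+_ (Φ′-outside c (X∉ ∘ ∈-++⁺ˡ)) (ΦL-outside cs (X∉ ∘ ∈-++⁺ʳ (nodeSets c)))

mutual
  Φ′-inside : WellFormed z → X ∈ᴸ nodeSets z → Φ′ false z X ≢ 0ℤ
  Φ′-inside {z = z@(node p cs)} w (here refl) =
    nonzero+zero (E-own z) (ΦL-outside cs (λ S∈cs → nodeSetsL≢S w S∈cs refl))
  Φ′-inside w@(node _ _ _ _ _) (there X∈cs) = Φ′-children w X∈cs

  Φ′-children : WellFormed (node p cs) → X ∈ᴸ nodeSetsL cs → Φ′ b (node p cs) X ≢ 0ℤ
  Φ′-children {p = p} {cs = cs} w@(node _ apart _ _ ws) X∈cs =
    zero+nonzero (E-elsewhere (node p cs) (nodeSetsL≢S w X∈cs ∘ sym)) (ΦL-inside apart ws X∈cs)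

  ΦL-inside : AllPairs _#_ cs → All WellFormed cs → X ∈ᴸ nodeSetsL cs → ΦL cs X ≢ 0ℤ
  ΦL-inside {cs = c ∷ cs} (c#cs ∷ apart) (w ∷ ws) m with ∈-++⁻ (nodeSets c) m
  ... | inj₁ X∈c = nonzero+zero (Φ′-inside w X∈c) (ΦL-outside cs (nodeSets-#-nodeSetsL c#cs w X∈c))
  ... | inj₂ X∈cs = zero+nonzero (Φ′-outside c (λ X∈c → nodeSets-#-nodeSetsL c#cs w X∈c X∈cs))
                                 (ΦL-inside apart ws X∈cs)

-- The root set cannot be read off Φ (a red root contributes nothing), hence S T₁ ≡ S T₂.
nodeSets-from-Φ : WellFormed T₁ → S T₁ ≡ S T₂ → Φ T₁ ≈FF Φ T₂ → nodeSets T₁ ⊆ᴸ nodeSets T₂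
nodeSets-from-Φ {T₂ = T₂} (node _ _ _ _ _) S≡ _ (here refl) =
  subst (_∈ᴸ nodeSets T₂) (sym S≡) (S∈nodeSets T₂)
nodeSets-from-Φ {T₂ = T₂} w@(node _ _ _ _ _) _ Φ≈ {X} (there X∈cs)
  with DecMembership._∈?_ (≡-dec _≟B_) X (nodeSets T₂)
... | yes X∈T₂ = X∈T₂
... | no X∉T₂ = ⊥-elim (Φ′-children w X∈cs (trans (Φ≈ X) (Φ′-outside T₂ X∉T₂)))

mutual
  ∈S⇒labelled : (z : Tree n) → x ∈ S z → Any (x ∈_) (labelSets z)
  ∈S⇒labelled (node p cs) x∈ with x∈p∪q⁻ p (SL cs) x∈
  ... | inj₁ x∈p = here x∈p
  ... | inj₂ x∈cs = there (∈SL⇒labelled cs x∈cs)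

  ∈SL⇒labelled : (cs : List (Tree n)) → x ∈ SL cs → Any (x ∈_) (labelSetsL cs)
  ∈SL⇒labelled [] x∈ = ⊥-elim (∉⊥ x∈)
  ∈SL⇒labelled (c ∷ cs) x∈ with x∈p∪q⁻ (S c) (SL cs) x∈
  ... | inj₁ x∈c = Any.++⁺ˡ (∈S⇒labelled c x∈c)
  ... | inj₂ x∈cs = Any.++⁺ʳ (labelSets c) (∈SL⇒labelled cs x∈cs)

mutual
  labelled⇒∈S : (z : Tree n) → Any (x ∈_) (labelSets z) → x ∈ S z
  labelled⇒∈S (node p cs) (here x∈p) = x∈p∪q⁺ (inj₁ x∈p)
  labelled⇒∈S (node p cs) (there x∈cs) = x∈p∪q⁺ (inj₂ (labelled⇒∈SL cs x∈cs))

  labelled⇒∈SL : (cs : List (Tree n)) → Any (x ∈_) (labelSetsL cs) → x ∈ SL cs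
  labelled⇒∈SL (c ∷ cs) x∈ with Any.++⁻ (labelSets c) x∈
  ... | inj₁ x∈c = x∈p∪q⁺ (inj₁ (labelled⇒∈S c x∈c))
  ... | inj₂ x∈cs = x∈p∪q⁺ (inj₂ (labelled⇒∈SL cs x∈cs))

S≡Full : (z : Tree n) → ⋃ (labelSets z) ≡ Full → S z ≡ Full
S≡Full z cover = ⊆-antisym ⊆⊤ (λ {x} _ → labelled⇒∈S z (∈⋃⁻ (labelSets z) (subst (x ∈_) (sym cover) ∈⊤)))

forest-# : (cs : List (Tree n)) → AllPairs Disjoint (labelSetsL cs) → AllPairs _#_ cs
forest-# [] _ = []
forest-# (c ∷ cs) pairs with AllPairs-++⁻ (labelSets c) pairs
... | _ , pairsᵣ , cross = All.tabulate c#d ∷ forest-# cs pairsᵣ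
  where
    c#d : d ∈ᴸ cs → c # d
    c#d d∈ = separated λ x∈c x∈d → case All.lookupAny cross (∈S⇒labelled c x∈c) of λ where
      (X#cs , x∈X) → Disjoint⇒¬Any X#cs x∈X (∈SL⇒labelled cs (S⊆SL d∈ x∈d))

sibling-element : AllPairs _#_ cs → All WellFormed cs → 2 ≤ length cs → c ∈ᴸ cs →
                  ∃ λ x → x ∈ SL cs × x ∉ S c
sibling-element {cs = a ∷ []} _ _ (s≤s ()) (here refl)
sibling-element {cs = a ∷ b ∷ rest} ((a#b ∷ _) ∷ _) (_ ∷ wb ∷ _) _ (here refl) with S-nonempty wb
... | x , x∈b = x , S⊆SL {cs = a ∷ b ∷ rest} (there (here refl)) x∈b , λ x∈a → separate a#b x∈a x∈b
sibling-element {cs = a ∷ rest} (a#rest ∷ _) (wa ∷ _) _ (there c∈rest) with S-nonempty wa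
... | x , x∈a = x , S⊆SL {cs = a ∷ rest} (here refl) x∈a , separate (All.lookup a#rest c∈rest) x∈a

children-⊂ : (∀ {x} → x ∈ p → x ∉ SL cs) → AllPairs _#_ cs → All WellFormed cs →
             (Empty p → 2 ≤ length cs) → All (λ c → S c ⊂ S (node p cs)) cs
children-⊂ {p = p} {cs = cs} p#cs apart ws branching =
  All.tabulate λ c∈ → q⊆p∪q p (SL cs) ∘ S⊆SL c∈ , missing c∈
  where
    missing : c ∈ᴸ cs → ∃ λ x → x ∈ S (node p cs) × x ∉ S c
    missing c∈ with nonempty? p
    ... | yes (x , x∈p) = x , x∈p∪q⁺ (inj₁ x∈p) , λ x∈c → p#cs x∈p (S⊆SL c∈ x∈c)
    ... | no p-empty with sibling-element apart ws (branching p-empty) c∈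
    ...   | x , x∈cs , x∉c = x , x∈p∪q⁺ (inj₂ x∈cs) , x∉c

node-nonempty : (Empty p → 2 ≤ length cs) → All WellFormed cs → Nonempty (S (node p cs))
node-nonempty {p = p} {cs = []} branching [] with nonempty? p
... | yes (x , x∈p) = x , x∈p∪q⁺ (inj₁ x∈p)
... | no p-empty with branching p-empty
...   | ()
node-nonempty {cs = c ∷ cs} _ (w ∷ _) with S-nonempty w
... | x , x∈c = x , x∈p∪q⁺ (inj₂ (S⊆SL {cs = c ∷ cs} (here refl) x∈c))

mutual
  wellFormed : (z : Tree n) → AllPairs Disjoint (labelSets z) → EmptyBranching z → WellFormed z
  wellFormed (node p cs) (p#cs ∷ pairs) (branching , branchingL) =
    node labels-apart apart (node-nonempty branching ws) (children-⊂ labels-apart apart ws branching) ws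
    where
      labels-apart : ∀ {x} → x ∈ p → x ∉ SL cs
      labels-apart x∈p x∈cs = Disjoint⇒¬Any p#cs x∈p (∈SL⇒labelled cs x∈cs)
      apart : AllPairs _#_ cs
      apart = forest-# cs pairs
      ws : All WellFormed cs
      ws = wellFormedL cs pairs branchingL

  wellFormedL : (cs : List (Tree n)) → AllPairs Disjoint (labelSetsL cs) → EmptyBranchingL cs →
                All WellFormed cs
  wellFormedL [] _ _ = []
  wellFormedL (c ∷ cs) pairs (branching , branchingL) with AllPairs-++⁻ (labelSets c) pairs
  ... | pairsₗ , pairsᵣ , _ = wellFormed c pairsₗ branching ∷ wellFormedL cs pairsᵣ branchingL

mainTheorem8 : ∀ (n : ℕ) → 1 ≤ n → ∀ (T₁ T₂ : Tree n) → IsBWTSL T₁ → IsBWTSL T₂ →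
                 Φ T₁ ≈FF Φ T₂ → T₁ ≅ T₂
mainTheorem8 n _ T₁ T₂ (disjoint₁ , cover₁ , branching₁) (disjoint₂ , cover₂ , branching₂) Φ≈ =
  ≅-from-nodeSets w₁ w₂ (nodeSets-from-Φ w₁ S≡ Φ≈) (nodeSets-from-Φ w₂ (sym S≡) (λ X → sym (Φ≈ X)))
  where
    w₁ : WellFormed T₁
    w₁ = wellFormed T₁ disjoint₁ branching₁
    w₂ : WellFormed T₂
    w₂ = wellFormed T₂ disjoint₂ branching₂
    S≡ : S T₁ ≡ S T₂
    S≡ = trans (S≡Full T₁ cover₁) (sym (S≡Full T₂ cover₂))
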